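{- Let $\Sigma\subseteq\Sigma''$ be finite alphabets, $act=\bigvee_{x\in\Sigma}x$, $a,b\in\Sigma''$, and $l\in\mathbb{N}$. Let $\hat X_{[l,\infty)}=\widetilde{\Box}\big[act\Rightarrow\big(b\Leftrightarrow\Diamond^{ - }_{[l,\infty)}(a\wedge act)\big)\big]$. Then one can construct a formula $\nu\in\mathsf{MTL}^{pw}[\mathcal{U}_I]$ over $\Sigma''$ such that for every finite timed word $\rho'$ over $\Sigma''$, $\rho'\models\hat X_{[l,\infty)}$ iff $\rho'\models\nu$.
   Context: A finite timed word over $\Sigma''$ is a sequence $(A_1,t_1)\dots(A_n,t_n)$, $n\ge1$, each $A_i$ a nonempty subset of $\Sigma''$, $t_i\in\mathbb{R}_{\ge0}$, $t_1<\dots<t_n$. MTL formulae: $\varphi::=a\mid BP\mid EP\mid true\mid\varphi\wedge\varphi\mid\neg\varphi\mid\varphi\,\mathcal{U}_I\,\varphi\mid\varphi\,\mathcal{S}_I\,\varphi$, $I$ an interval with endpoints in $\mathbb{N}\cup\{\infty\}$, with pointwise semantics: $a$ holds at position $i$ iff $a\in A_i$; $BP$/$EP$ hold exactly at the first/last position; $\rho,i\models\varphi_1\mathcal{U}_I\varphi_2$ iff $\exists j>i$ with $\rho,j\models\varphi_2$, $t_j-t_i\in I$, $\rho,k\models\varphi_1$ for $i<k<j$; $\mathcal{S}_I$ symmetric into the past. $\Diamond^{ - }_I\varphi=true\,\mathcal{S}_I\,\varphi$, $\Box\psi=\neg(true\,\mathcal{U}_{[0,\infty)}\neg\psi)$,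 $\widetilde{\Box}\psi=\psi\wedge\Box\psi$. $\rho'\models\varphi$ means satisfaction at the first position. $\mathsf{MTL}^{pw}[\mathcal{U}_I]$ is the set of formulae with no $\mathcal{S}$ operator.
   Formalization: The timestamps $t_i$ of the finite timed words over Σ'' are non-negative rationals instead of elements of $\mathbb{R}_{\ge0}$. -}

module Defs where

open import Data.Nat as ℕ using (ℕ; zero; suc)
open import Data.Fin using (Fin; toℕ)
open import Data.Fin.Subset using (Subset; _∈_; Nonempty; inside; outside)
open import Data.Vec using (lookup)
open import Data.List using (List; allFin; foldr)
open import Data.Integer using (+_)
open import Data.Rational using (ℚ; 0ℚ; _/_; _-_; _≤_; _<_)
open import Data.Bool using (Bool; true; false)
open import Data.Maybe using (Maybe; just; nothing)
open import Data.Product using (Σ; ∃; _×_; _,_)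
open import Data.Unit using (⊤)
open import Relation.Nullary using (¬_)
open import Level using (0ℓ)

ℕtoℚ : ℕ → ℚ
ℕtoℚ k = (+ k) / 1

-- Finite timed words over the alphabet Σ'' = Fin n.
-- A word of length suc len; positions are Fin (suc len).
-- FIDELITY: timestamps are non-negative rationals (no reals in stdlib).

record TimedWord (n : ℕ) : Set where
  field
    len      : ℕ
    letters  : Fin (suc len) → Subset n
    time     : Fin (suc len) → ℚ
    nonempty : ∀ i → Nonempty (letters i)
    nonneg   : ∀ i → 0ℚ ≤ time i
    strict   : ∀ i j → toℕ i ℕ.< toℕ j → time i < time j

Pos : ∀ {n} → TimedWord n → Set
Pos ρ = Fin (suc (TimedWord.len ρ))

-- Intervals with endpoints in ℕ ∪ {∞}.
-- lower bound `lo` (closed iff loClosed); upper bound `hi`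
-- (nothing = ∞, always open; just u = u, closed iff hiClosed).

record Interval : Set where
  constructor interval
  field
    lo       : ℕ
    loClosed : Bool
    hi       : Maybe ℕ
    hiClosed : Bool

_∈I_ : ℚ → Interval → Set
d ∈I interval lo lc hi hc = lower lc × upper hi hc
  where
  lower : Bool → Set
  lower true  = ℕtoℚ lo ≤ d
  lower false = ℕtoℚ lo < d
  upper : Maybe ℕ → Bool → Set
  upper nothing  _     = ⊤
  upper (just u) true  = d ≤ ℕtoℚ u
  upper (just u) false = d < ℕtoℚ u

data Formula (n : ℕ) : Set where
  atom  : Fin n → Formula n
  BP    : Formula n
  EP    : Formula n
  tt    : Formula n
  _∧_   : Formula n → Formula n → Formula n
  ¬'_   : Formula n → Formula n
  _U⟨_⟩_ : Formula n → Interval → Formula n → Formula n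
  _S⟨_⟩_ : Formula n → Interval → Formula n → Formula n

NoSince : ∀ {n} → Formula n → Set
NoSince (atom x)      = ⊤
NoSince BP            = ⊤
NoSince EP            = ⊤
NoSince tt            = ⊤
NoSince (φ ∧ ψ)       = NoSince φ × NoSince ψ
NoSince (¬' φ)        = NoSince φ
NoSince (φ U⟨ I ⟩ ψ)  = NoSince φ × NoSince ψ
NoSince (φ S⟨ I ⟩ ψ)  = Data.Empty.⊥
  where import Data.Empty

_,_⊨_ : ∀ {n} (ρ : TimedWord n) → Pos ρ → Formula n → Set
ρ , i ⊨ atom x = x ∈ TimedWord.letters ρ i
ρ , i ⊨ BP = toℕ i ≡ 0
  where open import Relation.Binary.PropositionalEquality using (_≡_)
ρ , i ⊨ EP = toℕ i ≡ TimedWord.len ρ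
  where open import Relation.Binary.PropositionalEquality using (_≡_)
ρ , i ⊨ tt = ⊤
ρ , i ⊨ (φ ∧ ψ) = (ρ , i ⊨ φ) × (ρ , i ⊨ ψ)
ρ , i ⊨ (¬' φ) = ¬ (ρ , i ⊨ φ)
ρ , i ⊨ (φ U⟨ I ⟩ ψ) =
  ∃ λ (j : Pos ρ) → toℕ i ℕ.< toℕ j × (ρ , j ⊨ ψ)
    × ((TimedWord.time ρ j - TimedWord.time ρ i) ∈I I)
    × (∀ (k : Pos ρ) → toℕ i ℕ.< toℕ k → toℕ k ℕ.< toℕ j → ρ , k ⊨ φ)
ρ , i ⊨ (φ S⟨ I ⟩ ψ) =
  ∃ λ (j : Pos ρ) → toℕ j ℕ.< toℕ i × (ρ , j ⊨ ψ)
    × ((TimedWord.time ρ i - TimedWord.time ρ j) ∈I I)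
    × (∀ (k : Pos ρ) → toℕ j ℕ.< toℕ k → toℕ k ℕ.< toℕ i → ρ , k ⊨ φ)

_⊨₀_ : ∀ {n} → TimedWord n → Formula n → Set
ρ ⊨₀ φ = ρ , Data.Fin.zero ⊨ φ

ff : ∀ {n} → Formula n
ff = ¬' tt

_∨'_ : ∀ {n} → Formula n → Formula n → Formula n
φ ∨' ψ = ¬' ((¬' φ) ∧ (¬' ψ))

_⇒'_ : ∀ {n} → Formula n → Formula n → Formula n
φ ⇒' ψ = (¬' φ) ∨' ψ

_⇔'_ : ∀ {n} → Formula n → Formula n → Formula n
φ ⇔' ψ = (φ ⇒' ψ) ∧ (ψ ⇒' φ)

I0∞ : Interval
I0∞ = interval 0 true nothing false

Il∞ : ℕ → Interval
Il∞ l = interval l true nothing false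

◇⁻ : ∀ {n} → Interval → Formula n → Formula n
◇⁻ I φ = tt S⟨ I ⟩ φ

□ : ∀ {n} → Formula n → Formula n
□ ψ = ¬' (tt U⟨ I0∞ ⟩ (¬' ψ))

□~ : ∀ {n} → Formula n → Formula n
□~ ψ = ψ ∧ □ ψ

act : ∀ {n} → Subset n → Formula n
act {n} Σ' = foldr step ff (allFin n)
  where
  step : Fin n → Formula n → Formula n
  step x r with lookup Σ' x
  ... | inside  = atom x ∨' r
  ... | outside = r

Xhat : ∀ {n} → Subset n → Fin n → Fin n → ℕ → Formula n
Xhat Σ' a b l = □~ (act Σ' ⇒' (atom b ⇔' ◇⁻ (Il∞ l) (atom a ∧ act Σ')))

{-# OPTIONS --safe #-}
-- Only the first position p carrying a ∧ act matters: an act position k satisfies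
-- ◇⁻[l,∞) (a ∧ act) iff p < k and t k − t p ≥ l, because every other witness is later than
-- p and hence closer to k.  So X̂ says that no act position before p (anywhere, if there is
-- no such p) carries b, and that from p on the act positions carry b exactly when at least
-- l time units have passed since p.  The latter only looks into the future of p, so it is
-- expressed by future modalities at p, and "p is the first such position" by an until.
module Submission where

open import Defs
open import Data.Nat using (ℕ)
open import Data.Fin using (Fin)
open import Data.Fin.Subset using (Subset)
open import Data.Product using (Σ-syntax; _×_)
open import Function.Bundles using (_⇔_)

import Data.Nat as ℕ
import Data.Nat.Properties as ℕ
open import Data.Fin using (zero; suc; toℕ; _<_; _≤_; _<?_)
open import Data.Fin.Properties using (<-cmp; <-irrefl; <-asym; any?; all?; toℕ-injective)
open import Data.Fin.Subset using (inside; outside)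
open import Data.Fin.Subset.Properties using (_∈?_)
open import Data.Vec using (lookup)
open import Data.List using ([]; _∷_; foldr; allFin)
import Data.Rational as ℚ
import Data.Rational.Properties as ℚ
open import Data.Product using (_,_; proj₁; proj₂; ∃)
open import Data.Product.Function.NonDependent.Propositional using (_×-⇔_)
open import Data.Sum using (_⊎_; inj₁; inj₂)
open import Data.Sum.Function.Propositional using (_⊎-⇔_)
open import Data.Unit using (tt)
open import Data.Empty using (⊥-elim)
open import Data.Bool using (true; false)
open import Data.Maybe using (just; nothing)
open import Function using (_∘_)
open import Function.Bundles using (mk⇔; Equivalence)
open import Function.Properties.Equivalence using () renaming (refl to ⇔-refl; sym to ⇔-sym; trans to ⇔-trans)
open import Level using (Level)
open import Relation.Nullary using (¬_; Dec; yes; no)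
open import Relation.Nullary.Decidable using (_×-dec_; _→-dec_; ¬?)
open import Relation.Binary using (tri<; tri≈; tri>)
open import Relation.Binary.PropositionalEquality using (refl; sym)
open import Relation.Unary using (Pred; Decidable)

open Equivalence using (to; from)

private
  variable
    n : ℕ
    ℓ : Level

NoSince-foldr : ∀ {A : Set} {f : A → Formula n → Formula n} →
  (∀ x r → NoSince r → NoSince (f x r)) → ∀ xs → NoSince (foldr f ff xs)
NoSince-foldr f-pres []       = tt
NoSince-foldr f-pres (x ∷ xs) = f-pres x _ (NoSince-foldr f-pres xs)

mutual
  NoSince-act : (Σ' : Subset n) → NoSince (act Σ')
  NoSince-act {n} Σ' = NoSince-foldr (NoSince-actStep Σ') (allFin n)

  -- The conclusion is NoSince applied to the step function local to act, which cannot be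
  -- named here; it is inferred from the use in NoSince-act.
  NoSince-actStep : (Σ' : Subset n) (x : Fin n) (r : Formula n) → NoSince r → _
  NoSince-actStep Σ' x r nr with lookup Σ' x
  ... | inside  = tt , nr
  ... | outside = nr

□⟨_⟩_ : Interval → Formula n → Formula n
□⟨ I ⟩ ψ = ¬' (tt U⟨ I ⟩ (¬' ψ))

_Ũ_ : Formula n → Formula n → Formula n
φ Ũ ψ = ψ ∨' (φ ∧ (φ U⟨ I0∞ ⟩ ψ))

I0l : ℕ → Interval
I0l l = interval 0 true (just l) false

module _ (C B G : Formula n) (l : ℕ) where

  quiet : Formula n
  quiet = (¬' G) ∧ (C ⇒' (¬' B))

  settled : Formula n
  settled = (C ⇒' (¬' B)) ∧ ((□⟨ I0l l ⟩ (C ⇒' (¬' B))) ∧ (□⟨ Il∞ l ⟩ (C ⇒' B)))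

  ν : Formula n
  ν = □~ quiet ∨' (quiet Ũ (G ∧ settled))

  NoSince-ν : NoSince C → NoSince B → NoSince G → NoSince ν
  NoSince-ν c b g = (q , tt , q) , (gs , q , q , gs)
    where
    q : NoSince quiet
    q = g , c , b
    gs : NoSince (G ∧ settled)
    gs = g , (c , b) , ((tt , c , b) , (tt , c , b))

_∈I?_ : (d : ℚ.ℚ) (I : Interval) → Dec (d ∈I I)
d ∈I? interval lo true  nothing  _     = (ℕtoℚ lo ℚ.≤? d) ×-dec yes tt
d ∈I? interval lo false nothing  _     = (ℕtoℚ lo ℚ.<? d) ×-dec yes tt
d ∈I? interval lo true  (just u) true  = (ℕtoℚ lo ℚ.≤? d) ×-dec (d ℚ.≤? ℕtoℚ u)
d ∈I? interval lo true  (just u) false = (ℕtoℚ lo ℚ.≤? d) ×-dec (d ℚ.<? ℕtoℚ u)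
d ∈I? interval lo false (just u) true  = (ℕtoℚ lo ℚ.<? d) ×-dec (d ℚ.≤? ℕtoℚ u)
d ∈I? interval lo false (just u) false = (ℕtoℚ lo ℚ.<? d) ×-dec (d ℚ.<? ℕtoℚ u)

_,_⊨?_ : (ρ : TimedWord n) (i : Pos ρ) (φ : Formula n) → Dec (ρ , i ⊨ φ)
ρ , i ⊨? atom x = x ∈? TimedWord.letters ρ i
ρ , i ⊨? BP = toℕ i ℕ.≟ 0
ρ , i ⊨? EP = toℕ i ℕ.≟ TimedWord.len ρ
ρ , i ⊨? tt = yes tt
ρ , i ⊨? (φ ∧ ψ) = (ρ , i ⊨? φ) ×-dec (ρ , i ⊨? ψ)
ρ , i ⊨? (¬' φ) = ¬? (ρ , i ⊨? φ)
ρ , i ⊨? (φ U⟨ I ⟩ ψ) = any? λ j → (i <? j) ×-dec (ρ , j ⊨? ψ) ×-dec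
  ((TimedWord.time ρ j ℚ.- TimedWord.time ρ i) ∈I? I) ×-dec
  all? λ k → (i <? k) →-dec (k <? j) →-dec (ρ , k ⊨? φ)
ρ , i ⊨? (φ S⟨ I ⟩ ψ) = any? λ j → (j <? i) ×-dec (ρ , j ⊨? ψ) ×-dec
  ((TimedWord.time ρ i ℚ.- TimedWord.time ρ j) ∈I? I) ×-dec
  all? λ k → (j <? k) →-dec (k <? i) →-dec (ρ , k ⊨? φ)

Least : Pred (Fin n) ℓ → Fin n → Set ℓ
Least P q = P q × (∀ k → k < q → ¬ P k)

least? : {P : Pred (Fin n) ℓ} → Decidable P → (∀ k → ¬ P k) ⊎ ∃ (Least P)
least? {ℕ.zero}  P? = inj₁ λ ()
least? {ℕ.suc n} P? with P? zero | least? (P? ∘ suc)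
... | yes p₀  | _ = inj₂ (zero , p₀ , λ _ ())
... | no ¬p₀ | inj₁ none = inj₁ λ { zero → ¬p₀ ; (suc k) → none k }
... | no ¬p₀ | inj₂ (q , pq , below) =
  inj₂ (suc q , pq , λ { zero _ → ¬p₀ ; (suc k) k<q → below k (ℕ.s<s⁻¹ k<q) })

module Semantics (ρ : TimedWord n) where

  open TimedWord ρ using (time; strict)

  elapsed : Pos ρ → Pos ρ → ℚ.ℚ
  elapsed i j = time j ℚ.- time i

  time-mono : ∀ {i j} → i ≤ j → time i ℚ.≤ time j
  time-mono {i} {j} i≤j with ℕ.m≤n⇒m<n∨m≡n i≤j
  ... | inj₁ i<j = ℚ.<⇒≤ (strict i j i<j)
  ... | inj₂ i≡j rewrite toℕ-injective i≡j = ℚ.≤-refl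

  elapsed-nonneg : ∀ {i j} → i ≤ j → ℕtoℚ 0 ℚ.≤ elapsed i j
  elapsed-nonneg {i} {j} i≤j =
    ℚ.≤-trans (ℚ.≤-reflexive (sym (ℚ.+-inverseʳ (time i))))
              (ℚ.+-monoˡ-≤ (ℚ.- time i) (time-mono i≤j))

  elapsed-antitone : ∀ {i j k} → i ≤ j → elapsed j k ℚ.≤ elapsed i k
  elapsed-antitone {i} {j} {k} i≤j = ℚ.+-monoʳ-≤ (time k) (ℚ.neg-antimono-≤ (time-mono i≤j))

  stable : ∀ {i} φ → ¬ ¬ ρ , i ⊨ φ → ρ , i ⊨ φ
  stable {i} φ ¬¬φ with ρ , i ⊨? φ
  ... | yes p = p
  ... | no ¬p = ⊥-elim (¬¬φ ¬p)

  ⊨-⇒ : ∀ {i} φ ψ → ρ , i ⊨ (φ ⇒' ψ) ⇔ (ρ , i ⊨ φ → ρ , i ⊨ ψ)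
  ⊨-⇒ φ ψ = mk⇔ (λ h x → stable ψ λ ¬y → h ((λ ¬x → ¬x x) , ¬y))
                (λ f (¬¬x , ¬y) → ¬¬x (λ x → ¬y (f x)))

  ⊨-⇔ : ∀ {i} φ ψ → ρ , i ⊨ (φ ⇔' ψ) ⇔ (ρ , i ⊨ φ ⇔ ρ , i ⊨ ψ)
  ⊨-⇔ φ ψ = mk⇔ (λ (f , g) → mk⇔ (to (⊨-⇒ φ ψ) f) (to (⊨-⇒ ψ φ) g))
                (λ e → from (⊨-⇒ φ ψ) (to e) , from (⊨-⇒ ψ φ) (from e))

  ⊨-∨ : ∀ {i} φ ψ → ρ , i ⊨ (φ ∨' ψ) ⇔ (ρ , i ⊨ φ ⊎ ρ , i ⊨ ψ)
  ⊨-∨ {i} φ ψ = mk⇔ decide (λ { (inj₁ x) (¬x , _) → ¬x x ; (inj₂ y) (_ , ¬y) → ¬y y })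
    where
    decide : ρ , i ⊨ (φ ∨' ψ) → ρ , i ⊨ φ ⊎ ρ , i ⊨ ψ
    decide h with ρ , i ⊨? φ | ρ , i ⊨? ψ
    ... | yes x | _     = inj₁ x
    ... | no ¬x | yes y = inj₂ y
    ... | no ¬x | no ¬y = ⊥-elim (h (¬x , ¬y))

  ⊨-□ : ∀ {i} I ψ {P : Pos ρ → Set} → (∀ j → ρ , j ⊨ ψ ⇔ P j) →
        ρ , i ⊨ (□⟨ I ⟩ ψ) ⇔ (∀ j → i < j → elapsed i j ∈I I → P j)
  ⊨-□ I ψ e = mk⇔
    (λ h j i<j d → to (e j) (stable ψ λ ¬ψ → h (j , i<j , ¬ψ , d , λ _ _ _ → tt)))
    (λ f (j , i<j , ¬ψ , d , _) → ¬ψ (from (e j) (f j i<j d)))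

  ⊨₀-□~ : ∀ ψ {P : Pos ρ → Set} → (∀ k → ρ , k ⊨ ψ ⇔ P k) → ρ ⊨₀ □~ ψ ⇔ (∀ k → P k)
  ⊨₀-□~ ψ e = mk⇔
    (λ (ψ₀ , later) → λ
      { zero    → to (e zero) ψ₀
      ; (suc k) → to (⊨-□ I0∞ ψ e) later (suc k) ℕ.z<s (elapsed-nonneg ℕ.z≤n , tt) })
    (λ f → from (e zero) (f zero) , from (⊨-□ I0∞ ψ e) (λ j _ _ → f j))

  ⊨₀-Ũ : ∀ φ ψ {P Q : Pos ρ → Set} → (∀ k → ρ , k ⊨ φ ⇔ P k) → (∀ k → ρ , k ⊨ ψ ⇔ Q k) →
         ρ ⊨₀ (φ Ũ ψ) ⇔ ∃ λ p → Q p × (∀ k → k < p → P k)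
  ⊨₀-Ũ φ ψ {P} {Q} eφ eψ = ⇔-trans (⊨-∨ ψ (φ ∧ (φ U⟨ I0∞ ⟩ ψ))) (mk⇔ decode encode)
    where
    decode : ρ ⊨₀ ψ ⊎ ρ ⊨₀ (φ ∧ (φ U⟨ I0∞ ⟩ ψ)) → ∃ λ p → Q p × (∀ k → k < p → P k)
    decode (inj₁ ψ₀) = zero , to (eψ zero) ψ₀ , λ _ ()
    decode (inj₂ (φ₀ , p , _ , ψp , _ , between)) = p , to (eψ p) ψp , λ
      { zero    _   → to (eφ zero) φ₀
      ; (suc k) k<p → to (eφ (suc k)) (between (suc k) ℕ.z<s k<p) }
    encode : (∃ λ p → Q p × (∀ k → k < p → P k)) → ρ ⊨₀ ψ ⊎ ρ ⊨₀ (φ ∧ (φ U⟨ I0∞ ⟩ ψ))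
    encode (zero  , q , _)     = inj₁ (from (eψ zero) q)
    encode (suc p , q , below) = inj₂ (from (eφ zero) (below zero ℕ.z<s) ,
      suc p , ℕ.z<s , from (eψ (suc p)) q , (elapsed-nonneg ℕ.z≤n , tt) ,
      λ k _ k<p → from (eφ k) (below k k<p))

  ⊨-◇⁻ : ∀ {i} l φ →
         ρ , i ⊨ ◇⁻ (Il∞ l) φ ⇔ ∃ λ j → j < i × ρ , j ⊨ φ × ℕtoℚ l ℚ.≤ elapsed j i
  ⊨-◇⁻ l φ = mk⇔ (λ (j , j<i , φj , (l≤d , _) , _) → j , j<i , φj , l≤d)
                 (λ (j , j<i , φj , l≤d) → j , j<i , φj , (l≤d , tt) , λ _ _ _ → tt)

module Correctness (ρ : TimedWord n) (C B G : Formula n) (l : ℕ) where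

  open Semantics ρ

  L : ℚ.ℚ
  L = ℕtoℚ l

  Silent : Pos ρ → Set
  Silent k = ρ , k ⊨ C → ¬ ρ , k ⊨ B

  Governed : (Pos ρ → Set) → Set
  Governed P = ∀ k → ρ , k ⊨ C → (ρ , k ⊨ B ⇔ P k)

  Past : Pos ρ → Set
  Past k = ∃ λ j → j < k × ρ , j ⊨ G × L ℚ.≤ elapsed j k

  After : Pos ρ → Pos ρ → Set
  After p k = p < k × L ℚ.≤ elapsed p k

  Quiet : Pos ρ → Set
  Quiet k = ¬ ρ , k ⊨ G × Silent k

  Settled : Pos ρ → Set
  Settled p = Silent p
            × (∀ j → p < j → elapsed p j ℚ.< L → Silent j)
            × (∀ j → p < j → L ℚ.≤ elapsed p j → ρ , j ⊨ C → ρ , j ⊨ B)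

  Nu : Set
  Nu = (∀ k → Quiet k) ⊎ ∃ λ p → (ρ , p ⊨ G × Settled p) × (∀ k → k < p → Quiet k)

  Xhat-sem : ρ ⊨₀ □~ (C ⇒' (B ⇔' ◇⁻ (Il∞ l) G)) ⇔ Governed Past
  Xhat-sem = ⊨₀-□~ (C ⇒' (B ⇔' D)) λ k → mk⇔
    (λ h c → ⇔-trans (to (⊨-⇔ B D) (to (⊨-⇒ C (B ⇔' D)) h c)) (⊨-◇⁻ l G))
    (λ g → from (⊨-⇒ C (B ⇔' D)) λ c → from (⊨-⇔ B D) (⇔-trans (g c) (⇔-sym (⊨-◇⁻ l G))))
    where
    D : Formula n
    D = ◇⁻ (Il∞ l) G

  ν-sem : ρ ⊨₀ ν C B G l ⇔ Nu
  ν-sem = ⇔-trans (⊨-∨ (□~ quiet′) (quiet′ Ũ (G ∧ settled′)))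
    (⊨₀-□~ quiet′ quiet-sem ⊎-⇔ ⊨₀-Ũ quiet′ (G ∧ settled′) quiet-sem λ p → ⇔-refl ×-⇔ settled-sem p)
    where
    quiet′ : Formula n
    quiet′ = quiet C B G l
    settled′ : Formula n
    settled′ = settled C B G l
    quiet-sem : ∀ k → ρ , k ⊨ quiet′ ⇔ Quiet k
    quiet-sem k = ⇔-refl ×-⇔ ⊨-⇒ C (¬' B)
    settled-sem : ∀ p → ρ , p ⊨ settled′ ⇔ Settled p
    settled-sem p = ⊨-⇒ C (¬' B) ×-⇔ near ×-⇔ far
      where
      near : ρ , p ⊨ (□⟨ I0l l ⟩ (C ⇒' (¬' B))) ⇔ (∀ j → p < j → elapsed p j ℚ.< L → Silent j)
      near = ⇔-trans (⊨-□ (I0l l) (C ⇒' (¬' B)) λ _ → ⊨-⇒ C (¬' B))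
        (mk⇔ (λ h j p<j d<L → h j p<j (elapsed-nonneg (ℕ.<⇒≤ p<j) , d<L))
             (λ h j p<j (_ , d<L) → h j p<j d<L))
      far : ρ , p ⊨ (□⟨ Il∞ l ⟩ (C ⇒' B)) ⇔
            (∀ j → p < j → L ℚ.≤ elapsed p j → ρ , j ⊨ C → ρ , j ⊨ B)
      far = ⇔-trans (⊨-□ (Il∞ l) (C ⇒' B) λ _ → ⊨-⇒ C B)
        (mk⇔ (λ h j p<j L≤d → h j p<j (L≤d , tt))
             (λ h j p<j (L≤d , _) → h j p<j L≤d))

  Governed-⇔ : ∀ {P P′ : Pos ρ → Set} → (∀ k → P k ⇔ P′ k) → Governed P ⇔ Governed P′
  Governed-⇔ e = mk⇔ (λ g k c → ⇔-trans (g k c) (e k)) (λ g k c → ⇔-trans (g k c) (⇔-sym (e k)))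

  Governed-never : ∀ {P : Pos ρ → Set} → (∀ k → ¬ P k) → Governed P ⇔ (∀ k → Silent k)
  Governed-never ¬P = mk⇔ (λ g k c → ¬P k ∘ to (g k c))
                          (λ s k c → mk⇔ (⊥-elim ∘ s k c) (⊥-elim ∘ ¬P k))

  never-Past : (∀ k → ¬ ρ , k ⊨ G) → ∀ k → ¬ Past k
  never-Past ¬G k (j , _ , Gj , _) = ¬G j Gj

  Past⇔After : ∀ {p} → Least (λ k → ρ , k ⊨ G) p → ∀ k → Past k ⇔ After p k
  Past⇔After {p} (Gp , before) k = mk⇔
    (λ (j , j<k , Gj , L≤d) → let p≤j = ℕ.≮⇒≥ (λ j<p → before j j<p Gj) in
      ℕ.≤-<-trans p≤j j<k , ℚ.≤-trans L≤d (elapsed-antitone p≤j))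
    (λ (p<k , L≤d) → p , p<k , Gp , L≤d)

  Governed-After : ∀ {p} → Governed (After p) ⇔ ((∀ k → k < p → Silent k) × Settled p)
  Governed-After {p} = mk⇔ split join
    where
    split : Governed (After p) → (∀ k → k < p → Silent k) × Settled p
    split g = (λ k k<p c → <-asym k<p ∘ proj₁ ∘ to (g k c))
            , (λ c → <-irrefl refl ∘ proj₁ ∘ to (g p c))
            , (λ j _ d<L c b → ℚ.<-irrefl refl (ℚ.<-≤-trans d<L (proj₂ (to (g j c) b))))
            , (λ j p<j L≤d c → from (g j c) (p<j , L≤d))
    join : (∀ k → k < p → Silent k) × Settled p → Governed (After p)
    join (before , at , near , far) k c with <-cmp k p
    ... | tri< k<p _ _ = mk⇔ (⊥-elim ∘ before k k<p c) (⊥-elim ∘ <-asym k<p ∘ proj₁)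
    ... | tri≈ _ refl _ = mk⇔ (⊥-elim ∘ at c) (⊥-elim ∘ <-irrefl refl ∘ proj₁)
    ... | tri> _ _ p<k with L ℚ.≤? elapsed p k
    ...   | yes L≤d = mk⇔ (λ _ → p<k , L≤d) (λ _ → far k p<k L≤d c)
    ...   | no  L≰d = mk⇔ (⊥-elim ∘ near k p<k (ℚ.≰⇒> L≰d) c) (⊥-elim ∘ L≰d ∘ proj₂)

  Governed-Past⇔Nu : Governed Past ⇔ Nu
  Governed-Past⇔Nu = mk⇔ (λ g → classify g (least? λ k → ρ , k ⊨? G)) recover
    where
    classify : Governed Past → (∀ k → ¬ ρ , k ⊨ G) ⊎ ∃ (Least (λ k → ρ , k ⊨ G)) → Nu
    classify g (inj₁ ¬G) = inj₁ λ k → ¬G k , to (Governed-never (never-Past ¬G)) g k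
    classify g (inj₂ (p , first@(Gp , before))) =
      let (silent , settledp) = to Governed-After (to (Governed-⇔ (Past⇔After first)) g)
      in inj₂ (p , (Gp , settledp) , λ k k<p → before k k<p , silent k k<p)
    recover : Nu → Governed Past
    recover (inj₁ quiet) = from (Governed-never (never-Past (proj₁ ∘ quiet))) (proj₂ ∘ quiet)
    recover (inj₂ (p , (Gp , settledp) , quiet)) =
      from (Governed-⇔ (Past⇔After (Gp , λ k → proj₁ ∘ quiet k)))
           (from Governed-After ((λ k → proj₂ ∘ quiet k) , settledp))

  Xhat⇔ν : ρ ⊨₀ □~ (C ⇒' (B ⇔' ◇⁻ (Il∞ l) G)) ⇔ ρ ⊨₀ ν C B G l
  Xhat⇔ν = ⇔-trans Xhat-sem (⇔-trans Governed-Past⇔Nu (⇔-sym ν-sem))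

lemma4 : (n : ℕ) (Σ' : Subset n) (a b : Fin n) (l : ℕ) →
    Σ[ ν ∈ Formula n ] (NoSince ν ×
      ((ρ : TimedWord n) → (ρ ⊨₀ Xhat Σ' a b l) ⇔ (ρ ⊨₀ ν)))
lemma4 n Σ' a b l =
  ν C B G l , NoSince-ν C B G l (NoSince-act Σ') tt (tt , NoSince-act Σ') ,
  λ ρ → Correctness.Xhat⇔ν ρ C B G l
  where
  C B G : Formula n
  C = act Σ'
  B = atom b
  G = atom a ∧ act Σ'
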